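{- For an integer $g\ge1$, let $\mathrm{ng}_{\mathrm{sym}}(g)$ denote the number of numerical semigroups of genus $g$ that are both reflective and symmetric. Then \[ \mathrm{ng}_{\mathrm{sym}}(g)=\begin{cases} 1 & \text{if } g=1,\\ \tau(g-1)-1 & \text{if } g>1,\end{cases} \] where $\tau(n)$ denotes the number of positive divisors of $n$.
   Context: A numerical semigroup is a submonoid $S$ of $(\mathbb{N}_0,+)$ with finite complement; its genus is $g(S)=\#(\mathbb{N}_0\setminus S)$ and, when $g(S)\ge1$, its Frobenius number $F(S)$ is the largest element of $\mathbb{N}_0\setminus S$. $S$ is symmetric if for every $z\in\mathbb{Z}$ exactly one of $z$ and $F(S)-z$ lies in $S$. A numerical semigroup $S$ of genus $g\ge1$ is reflective if for every integer $z$ with $0\le z\le g-1$, exactly one of $z$ and $z+g$ lies in $S$. -}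

module Defs where

open import Data.Nat using (ℕ; zero; suc; _+_; _≤_; _<_)
open import Data.Nat.Divisibility using (_∣?_)
open import Data.Integer as ℤ using (ℤ; +_; -[1+_])
open import Data.Bool using (Bool; true; false; not)
open import Data.List using (List; length; filter; applyUpTo)
open import Data.List.Membership.Propositional using (_∈_)
open import Data.List.Relation.Unary.Unique.Propositional using (Unique)
open import Data.Vec using (Vec; lookup)
open import Data.Fin using (Fin)
open import Data.Product using (Σ; ∃; _×_)
open import Function.Bundles using (_⇔_)
open import Relation.Binary.PropositionalEquality using (_≡_)

-- A subset of ℕ₀, given by its (decidable) characteristic function.
-- (Every numerical semigroup is cofinite, hence decidable, so this loses nothing.)
Subsetℕ : Set
Subsetℕ = ℕ → Bool

_∈S_ : ℕ → Subsetℕ → Set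
n ∈S S = S n ≡ true

_∉S_ : ℕ → Subsetℕ → Set
n ∉S S = S n ≡ false

IsNumericalSemigroup : Subsetℕ → Set
IsNumericalSemigroup S =
  (0 ∈S S) ×
  (∀ a b → a ∈S S → b ∈S S → (a + b) ∈S S) ×
  (∃ λ N → ∀ n → N ≤ n → n ∈S S)

HasGenus : Subsetℕ → ℕ → Set
HasGenus S g = Σ (List ℕ) λ L → Unique L × (length L ≡ g) × (∀ n → (n ∈ L) ⇔ (n ∉S S))

IsFrobenius : Subsetℕ → ℕ → Set
IsFrobenius S f = (f ∉S S) × (∀ n → n ∉S S → n ≤ f)

memℤ : Subsetℕ → ℤ → Bool
memℤ S (+ n) = S n
memℤ S -[1+ n ] = false

IsSymmetric : Subsetℕ → Set
IsSymmetric S = Σ ℕ λ F → IsFrobenius S F ×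
  (∀ (z : ℤ) → memℤ S z ≡ not (memℤ S ((+ F) ℤ.- z)))

IsReflective : Subsetℕ → ℕ → Set
IsReflective S g = ∀ z → z < g → S z ≡ not (S (z + g))

_≐_ : Subsetℕ → Subsetℕ → Set
S ≐ T = ∀ n → S n ≡ T n

HasCount : (Subsetℕ → Set) → ℕ → Set
HasCount P k = Σ (Vec Subsetℕ k) λ v →
  (∀ i → P (lookup v i)) ×
  (∀ i j → lookup v i ≐ lookup v j → i ≡ j) ×
  (∀ S → P S → ∃ λ (i : Fin k) → S ≐ lookup v i)

ReflSymOfGenus : ℕ → Subsetℕ → Set
ReflSymOfGenus g S = IsNumericalSemigroup S × HasGenus S g × IsReflective S g × IsSymmetric S

τ : ℕ → ℕ
τ n = length (filter (_∣? n) (applyUpTo suc n))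

-- A reflective S of genus g has exactly one gap in each pair {z, z + g} with z < g, so these
-- are all its gaps: S contains every x ≥ 2g and is determined by S ∩ [0, g). Symmetry then
-- forces F(S) = 2g − 1, and reflectivity turns x ↦ F − x into the mirror x ↦ (g − 1) − x on
-- [0, g − 1]. A numerical semigroup mirrored there is closed under differences below g − 1, so
-- S ∩ [0, g − 1] consists of the multiples of the least positive element d of S; d divides
-- g − 1, and d ≠ 1 since 1 ∈ S would put g = 0 + g into S. Conversely each divisor d ≥ 2 of
-- g − 1 gives such a semigroup, distinct d giving distinct semigroups; for g = 1 the only one is
-- ℕ ∖ {1}.

module Submission where

open import Defs
open import Data.Nat using (ℕ; zero; suc; _+_; _*_; _∸_; _≤_; _<_; z≤n; s≤s; s≤s⁻¹; z<s)
open import Data.Nat.Properties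
open import Data.Nat.Divisibility
  using (_∣_; _∣?_; divides; _∣0; ∣-refl; ∣m∸n∣n⇒∣m; ∣m+n∣m⇒∣n; ∣m∣n⇒∣m+n; ∣1⇒≡1; 1∣_; ∣-antisym; ∣⇒≤)
open import Data.Nat.Induction using (<-rec)
open import Data.Bool using (Bool; true; false; not; if_then_else_)
import Data.Bool as Bool
open import Data.Bool.Properties using (not-involutive; ¬-not)
open import Data.Fin using (Fin; zero; suc; toℕ; fromℕ<)
open import Data.Fin.Properties using (toℕ<n; toℕ-injective; toℕ-fromℕ<; injective⇒≤)
open import Data.List using (List; []; _∷_; length; lookup; tabulate; filter; applyUpTo)
import Data.List.Relation.Unary.All as All
open import Data.List.Relation.Unary.AllPairs using (_∷_)
import Data.List.Relation.Unary.AllPairs as AllPairs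
open import Data.Vec as Vec using (Vec)
open import Data.Vec.Properties using (lookup∘tabulate)
open import Data.List.Properties using (length-tabulate; filter-accept)
open import Data.List.Membership.Propositional using (_∈_)
open import Data.List.Membership.Propositional.Properties
  using (∈-tabulate⁺; ∈-tabulate⁻; ∈-lookup; ∈-filter⁺; ∈-filter⁻; ∈-applyUpTo⁺; ∈-applyUpTo⁻)
open import Data.List.Relation.Unary.Any using (index; here)
open import Data.List.Relation.Unary.Any.Properties using (lookup-index)
open import Data.List.Relation.Unary.Unique.Propositional using (Unique)
open import Data.List.Relation.Unary.Unique.Propositional.Properties using (tabulate⁺; filter⁺; applyUpTo⁺₁)
open import Data.Integer as ℤ using (+_; -[1+_])
import Data.Integer.Properties as ℤ
open import Data.Product using (∃; _×_; _,_; proj₁; proj₂)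
open import Function.Bundles using (mk⇔; Equivalence)
open import Function.Definitions using (Injective)
open import Relation.Nullary using (Dec; yes; no; does; ¬_; contradiction)
open import Relation.Nullary.Decidable using (does-⇔; dec-true; dec-false)
open import Relation.Binary.PropositionalEquality
open import Relation.Unary using (Decidable)
open import Function.Base using (_∘_; _∘′_)

variable
  S : Subsetℕ
  A : ℕ → Bool
  g n x y k F : ℕ

not-flip : ∀ {a b} → a ≡ not b → b ≡ not a
not-flip {b = b} a≡¬b = sym (trans (cong not a≡¬b) (not-involutive b))

∈S⇒¬∉S : x ∈S S → ¬ x ∉S S
∈S⇒¬∉S x∈S x∉S = contradiction (trans (sym x∈S) x∉S) λ ()

¬∉S⇒∈S : ¬ x ∉S S → x ∈S S
¬∉S⇒∈S = ¬-not

does≡true⇒ : ∀ {X : Set} (x? : Dec X) → does x? ≡ true → X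
does≡true⇒ (yes x) _ = x

data Zone (g : ℕ) : ℕ → Set where
  below     : x < g → Zone g x
  reflected : y < g → Zone g (y + g)
  beyond    : g + g ≤ x → Zone g x

zone : ∀ g x → Zone g x
zone g x with x <? g | x <? g + g
... | yes x<g | _        = below x<g
... | no x≮g  | yes x<2g = subst (Zone g) (m∸n+n≡m g≤x) (reflected (+-cancelʳ-< g (x ∸ g) g x∸g+g<2g))
  where
  g≤x : g ≤ x
  g≤x = ≮⇒≥ x≮g
  x∸g+g<2g : x ∸ g + g < g + g
  x∸g+g<2g = subst (_< g + g) (sym (m∸n+n≡m g≤x)) x<2g
... | no _    | no x≮2g  = beyond (≮⇒≥ x≮2g)

reflectiveSet : ℕ → (ℕ → Bool) → Subsetℕ
reflectiveSet g A x with x <? g | x <? g + g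
... | yes _ | _     = A x
... | no _  | yes _ = not (A (x ∸ g))
... | no _  | no _  = true

reflectiveSet-below : x < g → reflectiveSet g A x ≡ A x
reflectiveSet-below {x} {g} x<g with x <? g
... | yes _   = refl
... | no x≮g = contradiction x<g x≮g

reflectiveSet-reflected : y < g → reflectiveSet g A (y + g) ≡ not (A y)
reflectiveSet-reflected {y} {g} {A} y<g with y + g <? g | y + g <? g + g
... | yes y+g<g | _      = contradiction (m≤n+m g y) (<⇒≱ y+g<g)
... | no _      | yes _  = cong (not ∘′ A) (m+n∸n≡m y g)
... | no _      | no y+g≮2g = contradiction (+-monoˡ-< g y<g) y+g≮2g

reflectiveSet-beyond : g + g ≤ x → reflectiveSet g A x ≡ true
reflectiveSet-beyond {g} {x} 2g≤x with x <? g | x <? g + g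
... | yes x<g | _     = contradiction (≤-trans (m≤m+n g g) 2g≤x) (<⇒≱ x<g)
... | no _    | yes x<2g = contradiction 2g≤x (<⇒≱ x<2g)
... | no _    | no _  = refl

reflectiveSet-isReflective : IsReflective (reflectiveSet g A) g
reflectiveSet-isReflective {g} {A} z z<g = begin
  reflectiveSet g A z               ≡⟨ reflectiveSet-below z<g ⟩
  A z                               ≡⟨ not-involutive (A z) ⟨
  not (not (A z))                   ≡⟨ cong not (reflectiveSet-reflected z<g) ⟨
  not (reflectiveSet g A (z + g))   ∎
  where open ≡-Reasoning

injective⇒≤-length : ∀ {m} {xs : List ℕ} (h : Fin m → ℕ) →
                     Injective _≡_ _≡_ h → (∀ i → h i ∈ xs) → m ≤ length xs
injective⇒≤-length {xs = xs} h h-injective h∈xs = injective⇒≤ {f = index ∘ h∈xs} λ {i} {j} eq →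
  h-injective (begin
    h i                         ≡⟨ lookup-index (h∈xs i) ⟩
    lookup xs (index (h∈xs i))  ≡⟨ cong (lookup xs) eq ⟩
    lookup xs (index (h∈xs j))  ≡⟨ lookup-index (h∈xs j) ⟨
    h j                         ∎)
  where open ≡-Reasoning

module Reflective {S : Subsetℕ} {g : ℕ} (isReflective : IsReflective S g) where

  gapOf : Fin g → ℕ
  gapOf i = if S (toℕ i) then toℕ i + g else toℕ i

  gapOf-∉S : ∀ i → gapOf i ∉S S
  gapOf-∉S i with S (toℕ i) in i∈?S
  ... | true  = not-flip (trans (sym i∈?S) (isReflective (toℕ i) (toℕ<n i)))
  ... | false = i∈?S

  gapOf-< : ∀ i → gapOf i < g + g
  gapOf-< i with S (toℕ i)
  ... | true  = +-monoˡ-< g (toℕ<n i)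
  ... | false = ≤-trans (toℕ<n i) (m≤m+n g g)

  gapOf-injective : Injective _≡_ _≡_ gapOf
  gapOf-injective {i} {j} eq with S (toℕ i) | S (toℕ j)
  ... | true  | true  = toℕ-injective (+-cancelʳ-≡ g _ _ eq)
  ... | false | false = toℕ-injective eq
  ... | true  | false = contradiction (toℕ<n j) (≤⇒≯ (subst (g ≤_) eq (m≤n+m g (toℕ i))))
  ... | false | true  = contradiction (toℕ<n i) (≤⇒≯ (subst (g ≤_) (sym eq) (m≤n+m g (toℕ j))))

  gapOf-lower : ∀ i → toℕ i ∉S S → gapOf i ≡ toℕ i
  gapOf-lower i i∉S rewrite i∉S = refl

  gapOf-upper : ∀ i → (toℕ i + g) ∉S S → gapOf i ≡ toℕ i + g
  gapOf-upper i i+g∉S rewrite trans (isReflective (toℕ i) (toℕ<n i)) (cong not i+g∉S) = refl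

  ∉S⇒gapOf : x < g + g → x ∉S S → ∃ λ i → x ≡ gapOf i
  ∉S⇒gapOf {x} x<2g x∉S with zone g x
  ... | below x<g = fromℕ< x<g , sym (begin
    gapOf (fromℕ< x<g)  ≡⟨ gapOf-lower _ (subst (_∉S S) (sym (toℕ-fromℕ< x<g)) x∉S) ⟩
    toℕ (fromℕ< x<g)    ≡⟨ toℕ-fromℕ< x<g ⟩
    x                   ∎)
    where open ≡-Reasoning
  ... | reflected {y} y<g = fromℕ< y<g , sym (begin
    gapOf (fromℕ< y<g)     ≡⟨ gapOf-upper _ (subst (λ z → (z + g) ∉S S) (sym (toℕ-fromℕ< y<g)) x∉S) ⟩
    toℕ (fromℕ< y<g) + g   ≡⟨ cong (_+ g) (toℕ-fromℕ< y<g) ⟩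
    y + g                  ∎)
    where open ≡-Reasoning
  ... | beyond 2g≤x = contradiction 2g≤x (<⇒≱ x<2g)

  genus : (∀ x → g + g ≤ x → x ∈S S) → HasGenus S g
  genus beyond⊆S = tabulate gapOf , tabulate⁺ gapOf-injective , length-tabulate gapOf ,
                   λ x → mk⇔ ∈gaps⇒∉S ∉S⇒∈gaps
    where
    ∈gaps⇒∉S : x ∈ tabulate gapOf → x ∉S S
    ∈gaps⇒∉S x∈gaps with i , refl ← ∈-tabulate⁻ x∈gaps = gapOf-∉S i

    ∉S⇒∈gaps : x ∉S S → x ∈ tabulate gapOf
    ∉S⇒∈gaps {x} x∉S
      with i , refl ← ∉S⇒gapOf (≰⇒> λ 2g≤x → ∈S⇒¬∉S {S = S} (beyond⊆S x 2g≤x) x∉S) x∉S =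
      ∈-tabulate⁺ i

  -- A gap x ≥ 2g would be a (g + 1)-st gap besides the gapOf i.
  genus⇒beyond⊆S : HasGenus S g → ∀ x → g + g ≤ x → x ∈S S
  genus⇒beyond⊆S (gaps , _ , length≡g , ∈gaps⇔∉S) x 2g≤x = ¬∉S⇒∈S {S = S} x∉S⇒⊥
    where
    h : Fin (suc g) → ℕ
    h zero    = x
    h (suc i) = gapOf i

    h-injective : Injective _≡_ _≡_ h
    h-injective {zero}  {zero}  _  = refl
    h-injective {zero}  {suc j} eq = contradiction 2g≤x (<⇒≱ (subst (_< g + g) (sym eq) (gapOf-< j)))
    h-injective {suc i} {zero}  eq = contradiction 2g≤x (<⇒≱ (subst (_< g + g) eq (gapOf-< i)))
    h-injective {suc i} {suc j} eq = cong suc (gapOf-injective eq)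

    x∉S⇒⊥ : ¬ x ∉S S
    x∉S⇒⊥ x∉S = 1+n≰n (subst (suc g ≤_) length≡g (injective⇒≤-length h h-injective h∈gaps))
      where
      h∈gaps : ∀ i → h i ∈ gaps
      h∈gaps zero    = Equivalence.from (∈gaps⇔∉S x) x∉S
      h∈gaps (suc i) = Equivalence.from (∈gaps⇔∉S (gapOf i)) (gapOf-∉S i)

  ≐reflectiveSet : (∀ x → g + g ≤ x → x ∈S S) → (∀ x → x < g → S x ≡ A x) → S ≐ reflectiveSet g A
  ≐reflectiveSet {A = A} beyond⊆S S≡A x with zone g x
  ... | below x<g     = trans (S≡A x x<g) (sym (reflectiveSet-below {A = A} x<g))
  ... | reflected y<g = trans (not-flip (isReflective _ y<g))
                              (trans (cong not (S≡A _ y<g)) (sym (reflectiveSet-reflected {A = A} y<g)))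
  ... | beyond 2g≤x   = trans (beyond⊆S x 2g≤x) (sym (reflectiveSet-beyond {g} {A = A} 2g≤x))

frobenius<⇒∈S : IsFrobenius S F → ∀ k → F < k → k ∈S S
frobenius<⇒∈S {S = S} (_ , F-max) k F<k = ¬∉S⇒∈S {S = S} λ k∉S → <⇒≱ F<k (F-max k k∉S)

SymmetricAbout : Subsetℕ → ℕ → Set
SymmetricAbout S F = ∀ k → k ≤ F → S k ≡ not (S (F ∸ k))

memℤ-difference : ∀ S → k ≤ F → memℤ S (+ F ℤ.- + k) ≡ S (F ∸ k)
memℤ-difference {k} {F} S k≤F = cong (memℤ S) (trans (ℤ.m-n≡m⊖n F k) (ℤ.⊖-≥ k≤F))

memℤ-difference-negative : ∀ S → F < k → memℤ S (+ F ℤ.- + k) ≡ false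
memℤ-difference-negative {F} {k} S F<k
  rewrite ℤ.m-n≡m⊖n F k | ℤ.⊖-< F<k = memℤ-neg (k ∸ F) (m<n⇒0<n∸m F<k)
  where
  memℤ-neg : ∀ j → 0 < j → memℤ S (ℤ.- (+ j)) ≡ false
  memℤ-neg (suc j) _ = refl

symmetric⇒symmetricAbout : (∀ z → memℤ S z ≡ not (memℤ S (+ F ℤ.- z))) → SymmetricAbout S F
symmetric⇒symmetricAbout {S} {F} symmetric k k≤F =
  trans (symmetric (+ k)) (cong not (memℤ-difference S k≤F))

symmetricAbout⇒symmetric : SymmetricAbout S F → (∀ k → F < k → k ∈S S) →
                           ∀ z → memℤ S z ≡ not (memℤ S (+ F ℤ.- z))
symmetricAbout⇒symmetric {S} {F} symmetricAbout above⊆S (+ k) with k ≤? F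
... | yes k≤F = trans (symmetricAbout k k≤F) (cong not (sym (memℤ-difference S k≤F)))
... | no k≰F  = trans (above⊆S k (≰⇒> k≰F)) (cong not (sym (memℤ-difference-negative S (≰⇒> k≰F))))
symmetricAbout⇒symmetric {S} {F} _ above⊆S -[1+ k ] =
  cong not (sym (above⊆S (F + suc k) (m<m+n F z<s)))

Mirrored : Subsetℕ → ℕ → Set
Mirrored S n = ∀ x → x ≤ n → S x ≡ S (n ∸ x)

module _ {S : Subsetℕ} {n : ℕ} (isReflective : IsReflective S (suc n)) where

  reflective-dual : x ≤ n → S (n + suc n ∸ x) ≡ not (S (n ∸ x))
  reflective-dual {x} x≤n =
    trans (cong S (+-∸-comm (suc n) x≤n)) (not-flip (isReflective (n ∸ x) (s≤s (m∸n≤m n x))))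

  symmetricAbout⇒mirrored : SymmetricAbout S (n + suc n) → Mirrored S n
  symmetricAbout⇒mirrored symmetricAbout x x≤n = begin
    S x                      ≡⟨ symmetricAbout x (≤-trans x≤n (m≤m+n n (suc n))) ⟩
    not (S (n + suc n ∸ x))  ≡⟨ cong not (reflective-dual x≤n) ⟩
    not (not (S (n ∸ x)))    ≡⟨ not-involutive _ ⟩
    S (n ∸ x)                ∎
    where open ≡-Reasoning

  mirrored⇒symmetricAbout-≤ : Mirrored S n → x ≤ n → S x ≡ not (S (n + suc n ∸ x))
  mirrored⇒symmetricAbout-≤ {x} mirrored x≤n = begin
    S x                      ≡⟨ mirrored x x≤n ⟩
    S (n ∸ x)                ≡⟨ not-involutive _ ⟨
    not (not (S (n ∸ x)))    ≡⟨ cong not (reflective-dual x≤n) ⟨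
    not (S (n + suc n ∸ x))  ∎
    where open ≡-Reasoning

  mirrored⇒symmetricAbout : Mirrored S n → SymmetricAbout S (n + suc n)
  mirrored⇒symmetricAbout mirrored k k≤F with k ≤? n
  ... | yes k≤n = mirrored⇒symmetricAbout-≤ mirrored k≤n
  ... | no k≰n  = not-flip (subst (λ t → S (n + suc n ∸ k) ≡ not (S t)) (m∸[m∸n]≡n k≤F)
                                  (mirrored⇒symmetricAbout-≤ mirrored F∸k≤n))
    where
    F∸k≤n : n + suc n ∸ k ≤ n
    F∸k≤n = subst (n + suc n ∸ k ≤_) (m+n∸n≡m n (suc n)) (∸-monoʳ-≤ (n + suc n) (≰⇒> k≰n))

  frobenius≡ : (∀ x → suc n + suc n ≤ x → x ∈S S) → IsFrobenius S F → SymmetricAbout S F →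
               F ≡ n + suc n
  frobenius≡ {F} beyond⊆S frobenius@(F∉S , F-max) symmetricAbout = ≤-antisym F≤n+g n+g≤F
    where
    F≤n+g : F ≤ n + suc n
    F≤n+g = s≤s⁻¹ (≰⇒> λ 2g≤F → ∈S⇒¬∉S {S = S} (beyond⊆S F 2g≤F) F∉S)

    -- If F < n + g, then n ∉ S, so F ∸ n ∈ S by symmetry; but F ∸ n < g and
    -- (F ∸ n) + g = F + 1 ∈ S, against reflectivity.
    F≮n+g : ¬ F < n + suc n
    F≮n+g F<n+g = ∈S⇒¬∉S {S = S} F∸n∈S (trans (isReflective _ F∸n<g) (cong not F∸n+g∈S))
      where
      n∉S : n ∉S S
      n∉S = trans (isReflective n ≤-refl) (cong not (frobenius<⇒∈S frobenius _ F<n+g))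
      n≤F : n ≤ F
      n≤F = F-max n n∉S
      F∸n∈S : (F ∸ n) ∈S S
      F∸n∈S = trans (not-flip (symmetricAbout n n≤F)) (cong not n∉S)
      F∸n<g : F ∸ n < suc n
      F∸n<g = s≤s (subst (F ∸ n ≤_) (m+n∸n≡m n n)
                         (∸-monoˡ-≤ n (s≤s⁻¹ (subst (F <_) (+-suc n n) F<n+g))))
      F∸n+g≡1+F : F ∸ n + suc n ≡ suc F
      F∸n+g≡1+F = trans (+-suc (F ∸ n) n) (cong suc (m∸n+n≡m n≤F))
      F∸n+g∈S : (F ∸ n + suc n) ∈S S
      F∸n+g∈S = frobenius<⇒∈S frobenius _ (subst (F <_) (sym F∸n+g≡1+F) (n<1+n F))

    n+g≤F : n + suc n ≤ F
    n+g≤F = ≮⇒≥ F≮n+g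

least-satisfying : ∀ {P : ℕ → Set} → Decidable P → P n → ∃ λ m → P m × (∀ {k} → k < m → ¬ P k)
least-satisfying {zero}  P? P0 = 0 , P0 , λ ()
least-satisfying {suc n} P? P1+n with P? 0
... | yes P0 = 0 , P0 , λ ()
... | no ¬P0 with m , Pm , below-m ← least-satisfying {n} (P? ∘ suc) P1+n =
  suc m , Pm , λ { {zero} _ → ¬P0 ; {suc k} k<1+m → below-m (s≤s⁻¹ k<1+m) }

module MirroredNumericalSemigroup {S : Subsetℕ} {n : ℕ}
  (numerical : IsNumericalSemigroup S) (mirrored : Mirrored S n) where

  0∈S : 0 ∈S S
  0∈S = proj₁ numerical

  +-closed : ∀ a b → a ∈S S → b ∈S S → (a + b) ∈S S
  +-closed = proj₁ (proj₂ numerical)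

  n∈S : n ∈S S
  n∈S = trans (sym (mirrored 0 z≤n)) 0∈S

  ∸-closed : ∀ {a b} → a ∈S S → b ∈S S → a ≤ b → b ≤ n → (b ∸ a) ∈S S
  ∸-closed {a} {b} a∈S b∈S a≤b b≤n = begin
    S (b ∸ a)             ≡⟨ cong (λ t → S (t ∸ a)) (m∸[m∸n]≡n b≤n) ⟨
    S (n ∸ (n ∸ b) ∸ a)   ≡⟨ cong S (∸-+-assoc n (n ∸ b) a) ⟩
    S (n ∸ (n ∸ b + a))   ≡⟨ mirrored (n ∸ b + a) n∸b+a≤n ⟨
    S (n ∸ b + a)         ≡⟨ +-closed _ _ (trans (sym (mirrored b b≤n)) b∈S) a∈S ⟩
    true                  ∎
    where
    open ≡-Reasoning
    n∸b+a≤n : n ∸ b + a ≤ n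
    n∸b+a≤n = ≤-trans (+-monoʳ-≤ (n ∸ b) a≤b) (≤-reflexive (m∸n+n≡m b≤n))

  private
    leastPositive : ∃ λ m → (suc m) ∈S S × (∀ {k} → k < m → ¬ (suc k) ∈S S)
    leastPositive = least-satisfying (λ k → S (suc k) Bool.≟ true)
                                     (proj₂ (proj₂ (proj₂ numerical)) _ (n≤1+n _))

  d : ℕ
  d = suc (proj₁ leastPositive)

  d∈S : d ∈S S
  d∈S = proj₁ (proj₂ leastPositive)

  ∈S-below-d : x < d → x ∈S S → x ≡ 0
  ∈S-below-d {zero}  _       _     = refl
  ∈S-below-d {suc x} 1+x<d 1+x∈S = contradiction 1+x∈S (proj₂ (proj₂ leastPositive) (s≤s⁻¹ 1+x<d))

  ∣⇒∈S : d ∣ x → x ∈S S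
  ∣⇒∈S (divides q refl) = multiple∈S q
    where
    multiple∈S : ∀ q → (q * d) ∈S S
    multiple∈S zero    = 0∈S
    multiple∈S (suc q) = +-closed d (q * d) d∈S (multiple∈S q)

  ∈S⇒∣ : x ≤ n → x ∈S S → d ∣ x
  ∈S⇒∣ {x} = <-rec (λ x → x ≤ n → x ∈S S → d ∣ x) step x
    where
    step : ∀ x → (∀ {y} → y < x → y ≤ n → y ∈S S → d ∣ y) → x ≤ n → x ∈S S → d ∣ x
    step x rec x≤n x∈S with d ≤? x
    ... | yes d≤x = ∣m∸n∣n⇒∣m d d≤x (rec (∸-monoʳ-< z<s d≤x) (≤-trans (m∸n≤m x d) x≤n)
                                       (∸-closed d∈S x∈S d≤x x≤n)) ∣-refl
    ... | no d≰x rewrite ∈S-below-d (≰⇒> d≰x) x∈S = d ∣0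

  d∣n : d ∣ n
  d∣n = ∈S⇒∣ ≤-refl n∈S

∣-complement : ∀ {d} → d ∣ n → x ≤ n → d ∣ x → d ∣ n ∸ x
∣-complement {n} d∣n x≤n d∣x = ∣m+n∣m⇒∣n (subst (_ ∣_) (sym (m+[n∸m]≡n x≤n)) d∣n) d∣x

divisorSemigroup : ℕ → ℕ → Subsetℕ
divisorSemigroup g d = reflectiveSet g (λ x → does (d ∣? x))

module DivisorSemigroup {n d : ℕ} (2≤d : 2 ≤ d) (d∣n : d ∣ n) where

  private
    Sᵈ : Subsetℕ
    Sᵈ = divisorSemigroup (suc n) d

  isReflective : IsReflective Sᵈ (suc n)
  isReflective = reflectiveSet-isReflective

  beyond⊆Sᵈ : ∀ x → suc n + suc n ≤ x → x ∈S Sᵈ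
  beyond⊆Sᵈ x = reflectiveSet-beyond {suc n}

  d∤1+n : ¬ d ∣ suc n
  d∤1+n d∣1+n with s≤s () ← subst (2 ≤_) (∣1⇒≡1 (∣m+n∣m⇒∣n (subst (d ∣_) (+-comm 1 n) d∣1+n) d∣n)) 2≤d

  below-∈Sᵈ⇒∣ : x < suc n → x ∈S Sᵈ → d ∣ x
  below-∈Sᵈ⇒∣ {x} x<1+n x∈Sᵈ = does≡true⇒ (d ∣? x) (trans (sym (reflectiveSet-below x<1+n)) x∈Sᵈ)

  reflected-∈Sᵈ⇒∤ : y < suc n → (y + suc n) ∈S Sᵈ → ¬ d ∣ y
  reflected-∈Sᵈ⇒∤ {y} y<1+n y+g∈Sᵈ d∣y =
    ∈S⇒¬∉S {y + suc n} {Sᵈ} y+g∈Sᵈ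
      (trans (reflectiveSet-reflected y<1+n) (cong not (dec-true (d ∣? y) d∣y)))

  ∤⇒shifted-∈Sᵈ : ¬ d ∣ y → (y + suc n) ∈S Sᵈ
  ∤⇒shifted-∈Sᵈ {y} d∤y with y <? suc n
  ... | yes y<1+n = trans (reflectiveSet-reflected y<1+n) (cong not (dec-false (d ∣? y) d∤y))
  ... | no y≮1+n  = beyond⊆Sᵈ (y + suc n) (+-monoˡ-≤ (suc n) (≮⇒≥ y≮1+n))

  ∣⇒∈Sᵈ : d ∣ x → x ∈S Sᵈ
  ∣⇒∈Sᵈ {x} d∣x with zone (suc n) x
  ... | below x<1+n   = trans (reflectiveSet-below x<1+n) (dec-true (d ∣? x) d∣x)
  ... | reflected _   = ∤⇒shifted-∈Sᵈ λ d∣y → d∤1+n (∣m+n∣m⇒∣n d∣x d∣y)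
  ... | beyond 2g≤x   = beyond⊆Sᵈ x 2g≤x

  +-closed : ∀ a b → a ∈S Sᵈ → b ∈S Sᵈ → (a + b) ∈S Sᵈ
  +-closed a b a∈Sᵈ b∈Sᵈ with zone (suc n) a | zone (suc n) b
  ... | beyond 2g≤a | _ = beyond⊆Sᵈ _ (≤-trans 2g≤a (m≤m+n a b))
  ... | _ | beyond 2g≤b = beyond⊆Sᵈ _ (≤-trans 2g≤b (m≤n+m b a))
  ... | reflected {y} _ | reflected {z} _ = beyond⊆Sᵈ _ (+-mono-≤ (m≤n+m (suc n) y) (m≤n+m (suc n) z))
  ... | below a<1+n | below b<1+n =
    ∣⇒∈Sᵈ (∣m∣n⇒∣m+n (below-∈Sᵈ⇒∣ a<1+n a∈Sᵈ) (below-∈Sᵈ⇒∣ b<1+n b∈Sᵈ))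
  ... | below a<1+n | reflected {z} z<1+n =
    subst (_∈S Sᵈ) (+-assoc a z (suc n)) (∤⇒shifted-∈Sᵈ λ d∣a+z →
      reflected-∈Sᵈ⇒∤ z<1+n b∈Sᵈ (∣m+n∣m⇒∣n d∣a+z (below-∈Sᵈ⇒∣ a<1+n a∈Sᵈ)))
  ... | reflected {y} y<1+n | below b<1+n =
    subst (_∈S Sᵈ) (trans (+-assoc b y (suc n)) (+-comm b (y + suc n))) (∤⇒shifted-∈Sᵈ λ d∣b+y →
      reflected-∈Sᵈ⇒∤ y<1+n a∈Sᵈ (∣m+n∣m⇒∣n d∣b+y (below-∈Sᵈ⇒∣ b<1+n b∈Sᵈ)))

  mirrored : Mirrored Sᵈ n
  mirrored x x≤n = begin
    Sᵈ x                 ≡⟨ reflectiveSet-below (s≤s x≤n) ⟩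
    does (d ∣? x)        ≡⟨ does-⇔ (mk⇔ (∣-complement d∣n x≤n) d∣n∸x⇒d∣x) (d ∣? x) (d ∣? (n ∸ x)) ⟩
    does (d ∣? (n ∸ x))  ≡⟨ reflectiveSet-below (s≤s (m∸n≤m n x)) ⟨
    Sᵈ (n ∸ x)           ∎
    where
    open ≡-Reasoning
    d∣n∸x⇒d∣x : d ∣ n ∸ x → d ∣ x
    d∣n∸x⇒d∣x d∣n∸x = subst (d ∣_) (m∸[m∸n]≡n x≤n) (∣-complement d∣n (m∸n≤m n x) d∣n∸x)

  isFrobenius : IsFrobenius Sᵈ (n + suc n)
  isFrobenius = trans (reflectiveSet-reflected {n} {suc n} ≤-refl) (cong not (dec-true (d ∣? n) d∣n)) ,
                λ k k∉Sᵈ → ≮⇒≥ λ F<k → ∈S⇒¬∉S {k} {Sᵈ} (beyond⊆Sᵈ k F<k) k∉Sᵈ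

  reflSym : ReflSymOfGenus (suc n) Sᵈ
  reflSym = (∣⇒∈Sᵈ (d ∣0) , +-closed , (suc n + suc n , beyond⊆Sᵈ)) ,
            Reflective.genus isReflective beyond⊆Sᵈ ,
            isReflective ,
            n + suc n , isFrobenius ,
            symmetricAbout⇒symmetric (mirrored⇒symmetricAbout isReflective mirrored)
                                     (frobenius<⇒∈S isFrobenius)

reflSym⇒beyond⊆S : ReflSymOfGenus g S → ∀ x → g + g ≤ x → x ∈S S
reflSym⇒beyond⊆S (_ , genus , isReflective , _) = Reflective.genus⇒beyond⊆S isReflective genus

reflSym⇒mirrored : ReflSymOfGenus (suc n) S → Mirrored S n
reflSym⇒mirrored {n} {S} reflSym@(_ , _ , isReflective , F , isFrobenius , symmetric) =
  symmetricAbout⇒mirrored isReflective (subst (SymmetricAbout S) F≡n+g symmetricAboutF)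
  where
  symmetricAboutF : SymmetricAbout S F
  symmetricAboutF = symmetric⇒symmetricAbout symmetric
  F≡n+g : F ≡ n + suc n
  F≡n+g = frobenius≡ isReflective (reflSym⇒beyond⊆S reflSym) isFrobenius symmetricAboutF

reflSym⇒divisorSemigroup : ReflSymOfGenus (suc (suc n)) S →
                           ∃ λ d → 2 ≤ d × d ∣ suc n × S ≐ divisorSemigroup (suc (suc n)) d
reflSym⇒divisorSemigroup {n} {S} reflSym@(numerical , _ , isReflective , _) =
  d , 2≤d , d∣n , Reflective.≐reflectiveSet isReflective (reflSym⇒beyond⊆S reflSym) S≡d∣?
  where
  open MirroredNumericalSemigroup numerical (reflSym⇒mirrored reflSym)

  g∉S : suc (suc n) ∉S S
  g∉S = trans (not-flip (isReflective 0 z<s)) (cong not 0∈S)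

  2≤d : 2 ≤ d
  2≤d = ≤∧≢⇒< (s≤s z≤n) λ 1≡d →
    ∈S⇒¬∉S {S = S} (∣⇒∈S (subst (_∣ suc (suc n)) 1≡d (1∣ suc (suc n)))) g∉S

  S≡d∣? : ∀ x → x < suc (suc n) → S x ≡ does (d ∣? x)
  S≡d∣? x x<g with d ∣? x
  ... | yes d∣x = trans (∣⇒∈S d∣x) (sym (dec-true (d ∣? x) d∣x))
  ... | no d∤x  = trans (¬-not (d∤x ∘ ∈S⇒∣ (s≤s⁻¹ x<g))) (sym (dec-false (d ∣? x) d∤x))

Unique⇒lookup-injective : ∀ {xs : List ℕ} → Unique xs → ∀ {i j} → lookup xs i ≡ lookup xs j → i ≡ j
Unique⇒lookup-injective (_    ∷ _)    {zero}  {zero}  _  = refl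
Unique⇒lookup-injective (x∉xs ∷ _)    {zero}  {suc j} eq = contradiction eq (All.lookup x∉xs (∈-lookup j))
Unique⇒lookup-injective (x∉xs ∷ _)    {suc i} {zero}  eq =
  contradiction (sym eq) (All.lookup x∉xs (∈-lookup i))
Unique⇒lookup-injective (_    ∷ uniq) {suc i} {suc j} eq = cong suc (Unique⇒lookup-injective uniq eq)

hasCount-of-list : ∀ {P : Subsetℕ → Set} (f : ℕ → Subsetℕ) {ds : List ℕ} → Unique ds →
                   (∀ {d} → d ∈ ds → P (f d)) →
                   (∀ {d e} → d ∈ ds → e ∈ ds → f d ≐ f e → d ≡ e) →
                   (∀ S → P S → ∃ λ d → d ∈ ds × S ≐ f d) →
                   HasCount P (length ds)
hasCount-of-list {P} f {ds} unique sound injective complete =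
  fs , (λ i → subst P (sym (lookup-fs i)) (sound (∈-lookup i))) , fs-injective , fs-complete
  where
  fs : Vec Subsetℕ (length ds)
  fs = Vec.tabulate (f ∘ lookup ds)

  lookup-fs : ∀ i → Vec.lookup fs i ≡ f (lookup ds i)
  lookup-fs = lookup∘tabulate (f ∘ lookup ds)

  fs-injective : ∀ i j → Vec.lookup fs i ≐ Vec.lookup fs j → i ≡ j
  fs-injective i j fsᵢ≐fsⱼ = Unique⇒lookup-injective unique (injective (∈-lookup i) (∈-lookup j) λ x →
    trans (sym (cong-app (lookup-fs i) x)) (trans (fsᵢ≐fsⱼ x) (cong-app (lookup-fs j) x)))

  fs-complete : ∀ S → P S → ∃ λ i → S ≐ Vec.lookup fs i
  fs-complete S PS with d , d∈ds , S≐fd ← complete S PS =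
    index d∈ds ,
    λ x → trans (S≐fd x) (cong-app (trans (cong f (lookup-index d∈ds)) (sym (lookup-fs _))) x)

nontrivialDivisors : ℕ → List ℕ
nontrivialDivisors n = filter (_∣? suc n) (applyUpTo (λ i → 2 + i) n)

-- applyUpTo suc (suc n) unfolds to 1 ∷ applyUpTo (2 +_) n.
τ-suc : τ (suc n) ∸ 1 ≡ length (nontrivialDivisors n)
τ-suc {n} = cong (λ ds → length ds ∸ 1) (filter-accept (_∣? suc n) (1∣ suc n))

∈-nontrivialDivisors⁻ : ∀ {d} → d ∈ nontrivialDivisors n → 2 ≤ d × d ∣ suc n
∈-nontrivialDivisors⁻ {n} d∈ds
  with d∈range , d∣1+n ← ∈-filter⁻ (_∣? suc n) {xs = applyUpTo (λ i → 2 + i) n} d∈ds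
  with _ , _ , d≡2+i ← ∈-applyUpTo⁻ (λ i → 2 + i) {n = n} d∈range =
  subst (2 ≤_) (sym d≡2+i) (s≤s (s≤s z≤n)) , d∣1+n

∈-nontrivialDivisors⁺ : ∀ {d} → 2 ≤ d → d ∣ suc n → d ∈ nontrivialDivisors n
∈-nontrivialDivisors⁺ {n} (s≤s (s≤s z≤n)) d∣1+n =
  ∈-filter⁺ (_∣? suc n) (∈-applyUpTo⁺ (λ i → 2 + i) (s≤s⁻¹ (∣⇒≤ d∣1+n))) d∣1+n

nontrivialDivisors-unique : Unique (nontrivialDivisors n)
nontrivialDivisors-unique {n} =
  filter⁺ (_∣? suc n) (applyUpTo⁺₁ (λ i → 2 + i) n λ i<j _ → <⇒≢ i<j ∘ suc-injective ∘ suc-injective)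

divisorSemigroup-≐⇒∣ : ∀ {d e} → e < g → divisorSemigroup g d ≐ divisorSemigroup g e → d ∣ e
divisorSemigroup-≐⇒∣ {g} {d} {e} e<g Sᵈ≐Sᵉ = does≡true⇒ (d ∣? e) (begin
  does (d ∣? e)            ≡⟨ reflectiveSet-below e<g ⟨
  divisorSemigroup g d e   ≡⟨ Sᵈ≐Sᵉ e ⟩
  divisorSemigroup g e e   ≡⟨ reflectiveSet-below e<g ⟩
  does (e ∣? e)            ≡⟨ dec-true (e ∣? e) ∣-refl ⟩
  true                     ∎)
  where open ≡-Reasoning

divisorSemigroup-injective : ∀ {d e} → d < g → e < g →
                             divisorSemigroup g d ≐ divisorSemigroup g e → d ≡ e
divisorSemigroup-injective d<g e<g Sᵈ≐Sᵉ =
  ∣-antisym (divisorSemigroup-≐⇒∣ e<g Sᵈ≐Sᵉ) (divisorSemigroup-≐⇒∣ d<g (sym ∘ Sᵈ≐Sᵉ))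

count-genus-1 : HasCount (ReflSymOfGenus 1) 1
count-genus-1 =
  hasCount-of-list (divisorSemigroup 1) {2 ∷ []} (All.[] ∷ AllPairs.[]) sound injective complete
  where
  sound : ∀ {d} → d ∈ 2 ∷ [] → ReflSymOfGenus 1 (divisorSemigroup 1 d)
  sound (here refl) = DivisorSemigroup.reflSym (s≤s (s≤s z≤n)) (2 ∣0)

  injective : ∀ {d e} → d ∈ 2 ∷ [] → e ∈ 2 ∷ [] → divisorSemigroup 1 d ≐ divisorSemigroup 1 e → d ≡ e
  injective (here refl) (here refl) _ = refl

  complete : ∀ S → ReflSymOfGenus 1 S → ∃ λ d → d ∈ 2 ∷ [] × S ≐ divisorSemigroup 1 d
  complete S reflSym@((0∈S , _) , _ , isReflective , _) =
    2 , here refl , Reflective.≐reflectiveSet isReflective (reflSym⇒beyond⊆S reflSym)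
                      λ { zero _ → 0∈S ; (suc _) (s≤s ()) }

count-genus-2+ : HasCount (ReflSymOfGenus (suc (suc n))) (length (nontrivialDivisors n))
count-genus-2+ {n} = hasCount-of-list (divisorSemigroup (suc (suc n))) (nontrivialDivisors-unique {n})
  (λ d∈ds → let 2≤d , d∣1+n = ∈-nontrivialDivisors⁻ {n} d∈ds in DivisorSemigroup.reflSym 2≤d d∣1+n)
  (λ d∈ds e∈ds → divisorSemigroup-injective (divisor-bound d∈ds) (divisor-bound e∈ds))
  λ S reflSym → let d , 2≤d , d∣1+n , S≐Sᵈ = reflSym⇒divisorSemigroup reflSym in
                d , ∈-nontrivialDivisors⁺ {n} 2≤d d∣1+n , S≐Sᵈ
  where
  divisor-bound : ∀ {d} → d ∈ nontrivialDivisors n → d < suc (suc n)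
  divisor-bound d∈ds = s≤s (∣⇒≤ (proj₂ (∈-nontrivialDivisors⁻ {n} d∈ds)))

proposition5p3 : HasCount (ReflSymOfGenus 1) 1 ×
    (∀ (g : ℕ) → 1 < g → HasCount (ReflSymOfGenus g) (τ (g ∸ 1) ∸ 1))
proposition5p3 = count-genus-1 , λ
  { (suc (suc n)) _ →
      subst (HasCount (ReflSymOfGenus (suc (suc n)))) (sym (τ-suc {n})) (count-genus-2+ {n})
  ; (suc zero) (s≤s ()) }
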